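{- Let $a,s,t,u\in\mathbb{Z}_{\ge0}$. Then the polynomial \[ f(m,n)=\binom{u\binom ms\binom nt}{a} \] is a nonnegative PBC in $m$ and $n$.
   Context: For a polynomial (or number) $g$ and $k\in\mathbb{Z}_{\ge0}$, $\binom gk=\frac{g(g-1)\cdots(g-k+1)}{k!}$ for $k\ge1$ and $\binom g0=1$. A PBC is a polynomial $\sum_{k,l\ge0}\alpha_{k,l}\binom mk\binom nl$ (finite sum) with $\alpha_{k,l}\in\mathbb{Z}$; it is nonnegative if all $\alpha_{k,l}\ge0$. -}

module Defs where

open import Data.Nat using (ℕ; zero; suc; _+_; _*_)
open import Data.Nat.Combinatorics using (_C_)
open import Data.Product using (∃-syntax)
open import Relation.Binary.PropositionalEquality using (_≡_)

sumBelow : ℕ → (ℕ → ℕ) → ℕ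
sumBelow zero    f = 0
sumBelow (suc K) f = sumBelow K f + f K

-- Evaluation at (m , n) of the PBC  Σ_{k<K, l<L} α k l · C(m,k) · C(n,l).
-- The coefficients α are natural numbers, i.e. the PBC is nonnegative.
evalPBC : (K L : ℕ) → (α : ℕ → ℕ → ℕ) → ℕ → ℕ → ℕ
evalPBC K L α m n = sumBelow K (λ k → sumBelow L (λ l → α k l * ((m C k) * (n C l))))

f : (a s t u : ℕ) → ℕ → ℕ → ℕ
f a s t u m n = (u * ((m C s) * (n C t))) C a

IsNonnegPBC : (ℕ → ℕ → ℕ) → Set
IsNonnegPBC g = ∃[ K ] ∃[ L ] ∃[ α ] (∀ m n → g m n ≡ evalPBC K L α m n)

-- Nonnegative PBCs are closed under sums and products, and a function vanishing at m = 0
-- whose forward difference in m is a nonnegative PBC is one itself (hockey-stick identity).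
-- By Pascal's rule u·C(m+1,s+1)·C(n,t) = X + Y with X = u·C(m,s+1)·C(n,t) and
-- Y = u·C(m,s)·C(n,t), so by Vandermonde the forward difference of C(u·C(m,s+1)·C(n,t), a+1)
-- in m is Σ_{i+j=a+1, j≥1} C(X,i)·C(Y,j): a sum of products of instances with smaller (s, a).
-- The case s = 0 follows from the case t = 0 by the symmetry m ↔ n.
module Submission where

open import Defs
open import Data.Nat.Base using (ℕ; zero; suc; _+_; _*_; _⊔_; _≤_; _<_; _≤′_; ≤′-refl; ≤′-step; s≤s)
open import Data.Nat.Properties
open import Algebra.Properties.CommutativeSemigroup +-commutativeSemigroup using () renaming (interchange to +-interchange)
open import Data.Nat.Combinatorics using (_C_; nCk+nC[k+1]≡[n+1]C[k+1])
open import Data.Nat.Tactic.RingSolver using (solve-∀)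
open import Data.Product using (_,_)
open import Data.Sum using (inj₁; inj₂)
open import Function using (_∘_)
open import Relation.Nullary using (contradiction)
open import Relation.Binary.PropositionalEquality using (_≡_; _≢_; refl; sym; trans; cong; cong₂; ≢-sym; module ≡-Reasoning)
open ≡-Reasoning

variable
  i k₀ l₀ : ℕ
  F G : ℕ → ℕ
  g h : ℕ → ℕ → ℕ

nC0≡1 : ∀ n → n C 0 ≡ 1
nC0≡1 zero    = refl
nC0≡1 (suc n) = refl

nC0*m≡m : ∀ n m → (n C 0) * m ≡ m
nC0*m≡m n m = trans (cong (_* m) (nC0≡1 n)) (*-identityˡ m)

m*nC0≡m : ∀ m n → m * (n C 0) ≡ m
m*nC0≡m m n = trans (cong (m *_) (nC0≡1 n)) (*-identityʳ m)

pascal : ∀ n k → suc n C suc k ≡ n C k + n C suc k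
pascal n k = sym (nCk+nC[k+1]≡[n+1]C[k+1] n k)

sumBelow-cong : ∀ K → (∀ k → F k ≡ G k) → sumBelow K F ≡ sumBelow K G
sumBelow-cong zero    F≗G = refl
sumBelow-cong (suc K) F≗G = cong₂ _+_ (sumBelow-cong K F≗G) (F≗G K)

sumBelow-+ : ∀ K (F G : ℕ → ℕ) → sumBelow K (λ k → F k + G k) ≡ sumBelow K F + sumBelow K G
sumBelow-+ zero    F G = refl
sumBelow-+ (suc K) F G = begin
  sumBelow K (λ k → F k + G k) + (F K + G K)      ≡⟨ cong (_+ (F K + G K)) (sumBelow-+ K F G) ⟩
  sumBelow K F + sumBelow K G + (F K + G K)       ≡⟨ +-interchange (sumBelow K F) _ _ _ ⟩
  sumBelow K F + F K + (sumBelow K G + G K)       ∎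

*-distribˡ-sumBelow : ∀ c K (F : ℕ → ℕ) → c * sumBelow K F ≡ sumBelow K (λ k → c * F k)
*-distribˡ-sumBelow c zero    F = *-zeroʳ c
*-distribˡ-sumBelow c (suc K) F =
  trans (*-distribˡ-+ c (sumBelow K F) (F K)) (cong (_+ c * F K) (*-distribˡ-sumBelow c K F))

*-distribʳ-sumBelow : ∀ c K (F : ℕ → ℕ) → sumBelow K F * c ≡ sumBelow K (λ k → F k * c)
*-distribʳ-sumBelow c K F =
  trans (*-comm (sumBelow K F) c) (trans (*-distribˡ-sumBelow c K F) (sumBelow-cong K (λ k → *-comm c (F k))))

sumBelow-vanishing : ∀ K → (∀ k → k < K → F k ≡ 0) → sumBelow K F ≡ 0
sumBelow-vanishing zero    F≡0 = refl
sumBelow-vanishing (suc K) F≡0 =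
  cong₂ _+_ (sumBelow-vanishing K (λ k k<K → F≡0 k (m≤n⇒m≤1+n k<K))) (F≡0 K ≤-refl)

sumBelow-telescope : F 0 ≡ 0 → (∀ m → F (suc m) ≡ F m + G m) → ∀ m → F m ≡ sumBelow m G
sumBelow-telescope F0≡0 step zero    = F0≡0
sumBelow-telescope F0≡0 step (suc m) = trans (step m) (cong (_+ _) (sumBelow-telescope F0≡0 step m))

hockey-stick : ∀ m k → sumBelow m (_C k) ≡ m C suc k
hockey-stick zero    k = refl
hockey-stick (suc m) k = begin
  sumBelow m (_C k) + m C k   ≡⟨ cong (_+ m C k) (hockey-stick m k) ⟩
  m C suc k + m C k           ≡⟨ +-comm (m C suc k) (m C k) ⟩
  m C k + m C suc k           ≡⟨ nCk+nC[k+1]≡[n+1]C[k+1] m k ⟩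
  suc m C suc k               ∎

δ : ℕ → ℕ → ℕ
δ zero    zero    = 1
δ zero    (suc j) = 0
δ (suc i) zero    = 0
δ (suc i) (suc j) = δ i j

δ-diag : ∀ i → δ i i ≡ 1
δ-diag zero    = refl
δ-diag (suc i) = δ-diag i

δ-≢ : ∀ i j → i ≢ j → δ i j ≡ 0
δ-≢ zero    zero    i≢j = contradiction refl i≢j
δ-≢ zero    (suc j) i≢j = refl
δ-≢ (suc i) zero    i≢j = refl
δ-≢ (suc i) (suc j) i≢j = δ-≢ i j (i≢j ∘ cong suc)

sumBelow-δ : ∀ K (F : ℕ → ℕ) → i < K → sumBelow K (λ k → δ i k * F k) ≡ F i
sumBelow-δ {i} (suc K) F i<1+K with m<1+n⇒m<n∨m≡n i<1+K
... | inj₁ i<K = begin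
  sumBelow K (λ k → δ i k * F k) + δ i K * F K
    ≡⟨ cong₂ _+_ (sumBelow-δ K F i<K) (cong (_* F K) (δ-≢ i K (<⇒≢ i<K))) ⟩
  F i + 0
    ≡⟨ +-identityʳ (F i) ⟩
  F i
    ∎
... | inj₂ refl = begin
  sumBelow K (λ k → δ K k * F k) + δ K K * F K
    ≡⟨ cong₂ _+_ (sumBelow-vanishing K K>k) (cong (_* F K) (δ-diag K)) ⟩
  0 + 1 * F K
    ≡⟨ *-identityˡ (F K) ⟩
  F K
    ∎
  where
  K>k : ∀ k → k < K → δ K k * F k ≡ 0
  K>k k k<K = cong (_* F k) (δ-≢ K k (≢-sym (<⇒≢ k<K)))

evalPBC-separable : ∀ K L (β γ : ℕ → ℕ) m n →
  evalPBC K L (λ k l → β k * γ l) m n ≡ sumBelow K (λ k → β k * (m C k)) * sumBelow L (λ l → γ l * (n C l))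
evalPBC-separable K L β γ m n = begin
  sumBelow K (λ k → sumBelow L (λ l → β k * γ l * ((m C k) * (n C l))))
    ≡⟨ sumBelow-cong K (λ k → sumBelow-cong L (λ l → interchange (β k) (γ l) (m C k) (n C l))) ⟩
  sumBelow K (λ k → sumBelow L (λ l → β k * (m C k) * (γ l * (n C l))))
    ≡⟨ sumBelow-cong K (λ k → sym (*-distribˡ-sumBelow (β k * (m C k)) L _)) ⟩
  sumBelow K (λ k → β k * (m C k) * sumBelow L (λ l → γ l * (n C l)))
    ≡⟨ sym (*-distribʳ-sumBelow _ K _) ⟩
  sumBelow K (λ k → β k * (m C k)) * sumBelow L (λ l → γ l * (n C l))
    ∎
  where
  interchange : ∀ b c x y → b * c * (x * y) ≡ b * x * (c * y)
  interchange = solve-∀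

evalPBC-δ : ∀ {K L} → k₀ < K → l₀ < L →
            ∀ m n → evalPBC K L (λ k l → δ k₀ k * δ l₀ l) m n ≡ (m C k₀) * (n C l₀)
evalPBC-δ {k₀} {l₀} {K} {L} k₀<K l₀<L m n = begin
  evalPBC K L (λ k l → δ k₀ k * δ l₀ l) m n
    ≡⟨ evalPBC-separable K L (δ k₀) (δ l₀) m n ⟩
  sumBelow K (λ k → δ k₀ k * (m C k)) * sumBelow L (λ l → δ l₀ l * (n C l))
    ≡⟨ cong₂ _*_ (sumBelow-δ K (m C_) k₀<K) (sumBelow-δ L (n C_) l₀<L) ⟩
  (m C k₀) * (n C l₀)
    ∎

evalPBC-+ : ∀ K L (α β : ℕ → ℕ → ℕ) m n →
  evalPBC K L (λ k l → α k l + β k l) m n ≡ evalPBC K L α m n + evalPBC K L β m n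
evalPBC-+ K L α β m n = begin
  sumBelow K (λ k → sumBelow L (λ l → (α k l + β k l) * ((m C k) * (n C l))))
    ≡⟨ sumBelow-cong K (λ k → sumBelow-cong L (λ l → *-distribʳ-+ ((m C k) * (n C l)) (α k l) (β k l))) ⟩
  sumBelow K (λ k → sumBelow L (λ l → α k l * ((m C k) * (n C l)) + β k l * ((m C k) * (n C l))))
    ≡⟨ sumBelow-cong K (λ k → sumBelow-+ L _ _) ⟩
  sumBelow K (λ k → sumBelow L (λ l → α k l * ((m C k) * (n C l))) + sumBelow L (λ l → β k l * ((m C k) * (n C l))))
    ≡⟨ sumBelow-+ K _ _ ⟩
  evalPBC K L α m n + evalPBC K L β m n
    ∎

evalPBC-zero : ∀ K L m n → evalPBC K L (λ _ _ → 0) m n ≡ 0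
evalPBC-zero K L m n = sumBelow-vanishing K (λ k _ → sumBelow-vanishing L (λ l _ → refl))

-- An inductive presentation of IsNonnegPBC; `resp` stands in for function extensionality.
infixl 6 _⊕_

data NonnegPBC : (ℕ → ℕ → ℕ) → Set where
  binomials : ∀ k l → NonnegPBC (λ m n → (m C k) * (n C l))
  empty     : NonnegPBC (λ _ _ → 0)
  _⊕_       : NonnegPBC g → NonnegPBC h → NonnegPBC (λ m n → g m n + h m n)
  resp      : (∀ m n → g m n ≡ h m n) → NonnegPBC g → NonnegPBC h

coefficients : NonnegPBC g → ℕ → ℕ → ℕ
coefficients (binomials k₀ l₀) k l = δ k₀ k * δ l₀ l
coefficients empty             k l = 0
coefficients (p ⊕ q)           k l = coefficients p k l + coefficients q k l
coefficients (resp _ p)        k l = coefficients p k l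

indexBound : NonnegPBC g → ℕ
indexBound (binomials k l) = suc (k ⊔ l)
indexBound empty           = 0
indexBound (p ⊕ q)         = indexBound p ⊔ indexBound q
indexBound (resp _ p)      = indexBound p

evalPBC-coefficients : ∀ {B} (p : NonnegPBC g) → indexBound p ≤ B →
                       ∀ m n → g m n ≡ evalPBC B B (coefficients p) m n
evalPBC-coefficients (binomials k l) k⊔l<B m n =
  sym (evalPBC-δ (≤-trans (s≤s (m≤m⊔n k l)) k⊔l<B) (≤-trans (s≤s (m≤n⊔m k l)) k⊔l<B) m n)
evalPBC-coefficients {B = B} empty _ m n = sym (evalPBC-zero B B m n)
evalPBC-coefficients {B = B} (p ⊕ q) p⊔q≤B m n = trans
  (cong₂ _+_ (evalPBC-coefficients p (m⊔n≤o⇒m≤o _ _ p⊔q≤B) m n)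
             (evalPBC-coefficients q (m⊔n≤o⇒n≤o _ _ p⊔q≤B) m n))
  (sym (evalPBC-+ B B (coefficients p) (coefficients q) m n))
evalPBC-coefficients (resp g≗h p) p≤B m n = trans (sym (g≗h m n)) (evalPBC-coefficients p p≤B m n)

toIsNonnegPBC : NonnegPBC g → IsNonnegPBC g
toIsNonnegPBC p = indexBound p , indexBound p , coefficients p , evalPBC-coefficients p ≤-refl

swap : NonnegPBC g → NonnegPBC (λ m n → g n m)
swap (binomials k l) = resp (λ m n → *-comm (m C l) (n C k)) (binomials l k)
swap empty           = empty
swap (p ⊕ q)         = swap p ⊕ swap q
swap (resp g≗h p)    = resp (λ m n → g≗h n m) (swap p)

constant : ∀ c → NonnegPBC (λ _ _ → c)
constant zero    = empty
constant (suc c) = resp (λ m n → cong₂ (λ x y → x * y + c) (nC0≡1 m) (nC0≡1 n)) (binomials 0 0 ⊕ constant c)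

summation : NonnegPBC h → NonnegPBC (λ m n → sumBelow m (λ i → h i n))
summation (binomials k l) = resp Σ-binomials (binomials (suc k) l)
  where
  Σ-binomials : ∀ m n → (m C suc k) * (n C l) ≡ sumBelow m (λ i → (i C k) * (n C l))
  Σ-binomials m n = trans (cong (_* (n C l)) (sym (hockey-stick m k))) (*-distribʳ-sumBelow (n C l) m (_C k))
summation empty        = resp (λ m n → sym (sumBelow-vanishing m (λ _ _ → refl))) empty
summation (p ⊕ q)      = resp (λ m n → sym (sumBelow-+ m _ _)) (summation p ⊕ summation q)
summation (resp g≗h p) = resp (λ m n → sumBelow-cong m (λ i → g≗h i n)) (summation p)

antidifference : (∀ n → g 0 n ≡ 0) → (∀ m n → g (suc m) n ≡ g m n + h m n) → NonnegPBC h → NonnegPBC g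
antidifference g0≡0 Δg≡h p =
  resp (λ m n → sym (sumBelow-telescope (g0≡0 n) (λ m → Δg≡h m n) m)) (summation p)

binomial-*-binomial : ∀ i j l → NonnegPBC (λ m n → (m C i) * (m C j) * (n C l))
binomial-*-binomial zero j l =
  resp (λ m n → cong (_* (n C l)) (sym (nC0*m≡m m (m C j)))) (binomials j l)
binomial-*-binomial (suc i) zero l =
  resp (λ m n → cong (_* (n C l)) (sym (m*nC0≡m (m C suc i) m))) (binomials (suc i) l)
binomial-*-binomial (suc i) (suc j) l =
  antidifference (λ n → refl) Δ
    (binomial-*-binomial i j l ⊕ binomial-*-binomial i (suc j) l ⊕ binomial-*-binomial (suc i) j l)
  where
  expand : ∀ a b c d x → (a + b) * (c + d) * x ≡ b * d * x + (a * c * x + a * d * x + b * c * x)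
  expand = solve-∀
  Δ : ∀ m n → (suc m C suc i) * (suc m C suc j) * (n C l)
            ≡ (m C suc i) * (m C suc j) * (n C l)
              + ((m C i) * (m C j) * (n C l) + (m C i) * (m C suc j) * (n C l) + (m C suc i) * (m C j) * (n C l))
  Δ m n = trans (cong₂ (λ x y → x * y * (n C l)) (pascal m i) (pascal m j))
                (expand (m C i) (m C suc i) (m C j) (m C suc j) (n C l))

binomialᵐ-* : ∀ k → NonnegPBC g → NonnegPBC (λ m n → (m C k) * g m n)
binomialᵐ-* k (binomials i l) = resp (λ m n → *-assoc (m C k) (m C i) (n C l)) (binomial-*-binomial k i l)
binomialᵐ-* k empty           = resp (λ m n → sym (*-zeroʳ (m C k))) empty
binomialᵐ-* k (p ⊕ q)         = resp (λ m n → sym (*-distribˡ-+ (m C k) _ _)) (binomialᵐ-* k p ⊕ binomialᵐ-* k q)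
binomialᵐ-* k (resp g≗h p)    = resp (λ m n → cong ((m C k) *_) (g≗h m n)) (binomialᵐ-* k p)

binomialⁿ-* : ∀ l → NonnegPBC g → NonnegPBC (λ m n → (n C l) * g m n)
binomialⁿ-* l p = swap (binomialᵐ-* l (swap p))

infixl 7 _⊗_
_⊗_ : NonnegPBC g → NonnegPBC h → NonnegPBC (λ m n → g m n * h m n)
_⊗_ {h = h} (binomials k l) q =
  resp (λ m n → sym (*-assoc (m C k) (n C l) (h m n))) (binomialᵐ-* k (binomialⁿ-* l q))
empty ⊗ q = empty
_⊗_ {h = h} (_⊕_ {g₁} {g₂} p₁ p₂) q =
  resp (λ m n → sym (*-distribʳ-+ (h m n) (g₁ m n) (g₂ m n))) (p₁ ⊗ q ⊕ p₂ ⊗ q)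
_⊗_ {h = h} (resp g≗g′ p) q = resp (λ m n → cong (_* h m n) (g≗g′ m n)) (p ⊗ q)

-- convolve x y a = Σ_{i+j=a} x i · y j
convolve : (ℕ → ℕ) → (ℕ → ℕ) → ℕ → ℕ
convolve x y zero    = x 0 * y 0
convolve x y (suc a) = x (suc a) * y 0 + convolve x (y ∘ suc) a

convolve-congʳ : ∀ x {y y′ : ℕ → ℕ} a → (∀ j → y j ≡ y′ j) → convolve x y a ≡ convolve x y′ a
convolve-congʳ x zero    y≗y′ = cong (x 0 *_) (y≗y′ 0)
convolve-congʳ x (suc a) y≗y′ = cong₂ _+_ (cong (x (suc a) *_) (y≗y′ 0)) (convolve-congʳ x a (y≗y′ ∘ suc))

convolve-+ʳ : ∀ x y z a → convolve x (λ j → y j + z j) a ≡ convolve x y a + convolve x z a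
convolve-+ʳ x y z zero    = *-distribˡ-+ (x 0) (y 0) (z 0)
convolve-+ʳ x y z (suc a) = begin
  x (suc a) * (y 0 + z 0) + convolve x (λ j → y (suc j) + z (suc j)) a
    ≡⟨ cong₂ _+_ (*-distribˡ-+ (x (suc a)) (y 0) (z 0)) (convolve-+ʳ x (y ∘ suc) (z ∘ suc) a) ⟩
  (x (suc a) * y 0 + x (suc a) * z 0) + (convolve x (y ∘ suc) a + convolve x (z ∘ suc) a)
    ≡⟨ +-interchange (x (suc a) * y 0) _ _ _ ⟩
  convolve x y (suc a) + convolve x z (suc a)
    ∎

convolve-unitʳ : ∀ x a → convolve x (0 C_) a ≡ x a
convolve-unitʳ x zero    = *-identityʳ (x 0)
convolve-unitʳ x (suc a) = begin
  x (suc a) * 1 + convolve x (λ _ → 0) a   ≡⟨ cong₂ _+_ (*-identityʳ (x (suc a))) (convolve-zeroʳ a) ⟩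
  x (suc a) + 0                            ≡⟨ +-identityʳ (x (suc a)) ⟩
  x (suc a)                                ∎
  where
  convolve-zeroʳ : ∀ a → convolve x (λ _ → 0) a ≡ 0
  convolve-zeroʳ zero    = *-zeroʳ (x 0)
  convolve-zeroʳ (suc a) = trans (cong (_+ convolve x (λ _ → 0) a) (*-zeroʳ (x (suc a)))) (convolve-zeroʳ a)

vandermonde : ∀ x y a → (x + y) C a ≡ convolve (x C_) (y C_) a
vandermonde x zero    a       = trans (cong (_C a) (+-identityʳ x)) (sym (convolve-unitʳ (x C_) a))
vandermonde x (suc y) zero    = trans (nC0≡1 (x + suc y)) (sym (cong₂ _*_ (nC0≡1 x) (nC0≡1 (suc y))))
vandermonde x (suc y) (suc a) = begin
  (x + suc y) C suc a
    ≡⟨ cong (_C suc a) (+-suc x y) ⟩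
  suc (x + y) C suc a
    ≡⟨ pascal (x + y) a ⟩
  (x + y) C a + (x + y) C suc a
    ≡⟨ cong₂ _+_ (vandermonde x y a) (vandermonde x y (suc a)) ⟩
  convolve X Y a + (X (suc a) * Y 0 + convolve X (Y ∘ suc) a)
    ≡⟨ cong (λ c → convolve X Y a + (X (suc a) * c + convolve X (Y ∘ suc) a)) Y0≡Y′0 ⟩
  convolve X Y a + (X (suc a) * Y′ 0 + convolve X (Y ∘ suc) a)
    ≡⟨ +-rotate (convolve X Y a) (X (suc a) * Y′ 0) (convolve X (Y ∘ suc) a) ⟩
  X (suc a) * Y′ 0 + (convolve X Y a + convolve X (Y ∘ suc) a)
    ≡⟨ cong (X (suc a) * Y′ 0 +_) (sym (convolve-+ʳ X Y (Y ∘ suc) a)) ⟩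
  X (suc a) * Y′ 0 + convolve X (λ j → Y j + Y (suc j)) a
    ≡⟨ cong (X (suc a) * Y′ 0 +_) (convolve-congʳ X a (λ j → sym (pascal y j))) ⟩
  convolve X Y′ (suc a)
    ∎
  where
  X Y Y′ : ℕ → ℕ
  X  = x C_
  Y  = y C_
  Y′ = suc y C_
  Y0≡Y′0 : Y 0 ≡ Y′ 0
  Y0≡Y′0 = trans (nC0≡1 y) (sym (nC0≡1 (suc y)))
  +-rotate : ∀ a b c → a + (b + c) ≡ b + (a + c)
  +-rotate = solve-∀

vandermonde-suc : ∀ x y a → (x + y) C suc a ≡ x C suc a + convolve (x C_) (λ j → y C suc j) a
vandermonde-suc x y a =
  trans (vandermonde x y (suc a)) (cong (_+ convolve (x C_) (λ j → y C suc j) a) (m*nC0≡m (x C suc a) y))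

convolve-closed : ∀ {x y : ℕ → ℕ → ℕ → ℕ} a → (∀ i → i ≤′ a → NonnegPBC (x i)) → (∀ j → NonnegPBC (y j)) →
                  NonnegPBC (λ m n → convolve (λ i → x i m n) (λ j → y j m n) a)
convolve-closed zero    px py = px 0 ≤′-refl ⊗ py 0
convolve-closed (suc a) px py =
  px (suc a) ≤′-refl ⊗ py 0 ⊕ convolve-closed a (λ i i≤a → px i (≤′-step i≤a)) (py ∘ suc)

module _ (u t : ℕ) (s≡0-case : ∀ a → NonnegPBC (f a 0 t u)) where

  binomial-of-monomial-from-s≡0 : ∀ s a → NonnegPBC (f a s t u)
  binomial-of-monomial-from-s≡0-≤′ : ∀ s {a} i → i ≤′ a → NonnegPBC (f i s t u)

  binomial-of-monomial-from-s≡0-≤′ s {a} .a ≤′-refl = binomial-of-monomial-from-s≡0 s a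
  binomial-of-monomial-from-s≡0-≤′ s i (≤′-step i≤′a) = binomial-of-monomial-from-s≡0-≤′ s i i≤′a

  binomial-of-monomial-from-s≡0 zero    a    = s≡0-case a
  binomial-of-monomial-from-s≡0 (suc s) zero =
    resp (λ m n → sym (nC0≡1 (u * ((m C suc s) * (n C t))))) (constant 1)
  binomial-of-monomial-from-s≡0 (suc s) (suc a) =
    antidifference vanishes-at-0 Δ
      (convolve-closed a (binomial-of-monomial-from-s≡0-≤′ (suc s))
                         (λ j → binomial-of-monomial-from-s≡0 s (suc j)))
    where
    vanishes-at-0 : ∀ n → f (suc a) (suc s) t u 0 n ≡ 0
    vanishes-at-0 n = cong (_C suc a) (*-zeroʳ u)
    split : ∀ m n → u * ((suc m C suc s) * (n C t)) ≡ u * ((m C suc s) * (n C t)) + u * ((m C s) * (n C t))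
    split m n = trans (cong (λ c → u * (c * (n C t))) (pascal m s)) (distrib u (m C s) (m C suc s) (n C t))
      where
      distrib : ∀ u x y z → u * ((x + y) * z) ≡ u * (y * z) + u * (x * z)
      distrib = solve-∀
    Δ : ∀ m n → f (suc a) (suc s) t u (suc m) n
              ≡ f (suc a) (suc s) t u m n + convolve (λ i → f i (suc s) t u m n) (λ j → f (suc j) s t u m n) a
    Δ m n = trans (cong (_C suc a) (split m n)) (vandermonde-suc _ _ a)

binomial-of-monomial : ∀ u s t a → NonnegPBC (f a s t u)
binomial-of-monomial u s t = binomial-of-monomial-from-s≡0 u t s≡0-case s
  where
  s≡t≡0-case : ∀ a → NonnegPBC (f a 0 0 u)
  s≡t≡0-case a =
    resp (λ m n → cong (λ c → (u * c) C a) (sym (cong₂ _*_ (nC0≡1 m) (nC0≡1 n)))) (constant ((u * 1) C a))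
  s≡0-case : ∀ a → NonnegPBC (f a 0 t u)
  s≡0-case a = resp (λ m n → cong (λ c → (u * c) C a) (*-comm (n C t) (m C 0)))
                    (swap (binomial-of-monomial-from-s≡0 u 0 s≡t≡0-case t a))

lemma2p6 : (a s t u : ℕ) → IsNonnegPBC (f a s t u)
lemma2p6 a s t u = toIsNonnegPBC (binomial-of-monomial u s t a)
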